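{- Let $a(n,k)$ be the number of non-squashing partitions of $n$ into exactly $k$ parts. Then $$a(2m,k)=a(2m-1,k)+a(m,k-1)\ \ (m\ge1,k\ge1),\qquad a(2m+1,k)=a(2m,k)\ \ (m\ge 1,k\ge 1),$$ with $a(0,0)=1$, $a(n,0)=0$ for $n\ge1$, $a(n,k)=0$ for $k>n$, and $a(n,1)=1$ for $n\ge 1$. Moreover, for each $k\ge 2$, $$\sum_{m=0}^{\infty}a(2m,k)x^m=\frac{x^{2^{k-2}}}{(1-x)\prod_{j=0}^{k-2}(1-x^{2^j})},$$ and for each $k\ge 1$, $$\sum_{m=0}^{\infty}a(m,k)x^m=\frac{x^{2^{k-1}}}{\prod_{j=0}^{k-1}(1-x^{2^j})}.$$ Consequently, for $k\ge1$, the number of non-squashing partitions of $n$ with $k$ parts equals (i) the number of partitions of $n-2^{k-1}$ into powers of $2$ not exceeding $2^{k-1}$, and (ii) the number of partitions of $n$ into powers of $2$ whose largest part is $2^{k-1}$.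
   Context: A partition $n=p_1+p_2+\cdots+p_k$ with parts written in nondecreasing order $1\le p_1\le\cdots\le p_k$ is called non-squashing if $p_1+\cdots+p_j\le p_{j+1}$ for all $1\le j\le k-1$. The empty partition of $0$ is the unique partition with $0$ parts. -}

module Defs where

open import Data.Nat using (ℕ; zero; suc; _+_; _*_; _∸_; _^_; _≤_; _<_; _⊔_; z≤n; s≤s; _≟_; _≤?_)
open import Data.Nat.Properties using (≤-trans; +-monoˡ-≤; ≤-refl; m≤m+n; +-identityʳ; <-≤-trans; n<1+n; n≤1+n)
open import Data.Integer as ℤ using (ℤ; 0ℤ; 1ℤ)
open import Data.List using (List; []; _∷_; length; map; concatMap; upTo; filter; foldr)
open import Data.Nat.ListAction using (sum)
open import Data.List.Relation.Unary.All using (All; all?)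
open import Data.List.Relation.Unary.Any using (Any)
open import Data.List.Relation.Unary.Linked using (Linked; linked?)
open import Data.Fin using (Fin; toℕ; fromℕ<)
open import Data.Fin.Properties using (any?; toℕ-fromℕ<)
open import Data.Product using (Σ; ∃; ∃-syntax; _×_; _,_)
open import Data.Unit using (⊤; tt)
open import Relation.Nullary using (Dec; yes; no; ¬_)
open import Relation.Nullary.Decidable using (_×-dec_; map′)
open import Relation.Binary.PropositionalEquality using (_≡_; refl; sym; subst; cong)
open import Relation.Unary using (Pred; Decidable)
open import Function using (_∘_)
import Agda.Primitive

IsPartition : ℕ → List ℕ → Set
IsPartition n p = All (1 ≤_) p × Linked _≤_ p × sum p ≡ n

-- Non-squashing condition:  p₁ + ⋯ + p_j ≤ p_{j+1}  for 1 ≤ j ≤ k-1.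
-- NS acc q : every part of q is at least acc plus the sum of the parts before it.
NS : ℕ → List ℕ → Set
NS acc []       = ⊤
NS acc (x ∷ xs) = acc ≤ x × NS (acc + x) xs

NonSquashing : List ℕ → Set
NonSquashing []       = ⊤
NonSquashing (x ∷ xs) = NS x xs

listsOfLength : ℕ → ℕ → List (List ℕ)
listsOfLength zero    n = [] ∷ []
listsOfLength (suc ℓ) n = concatMap (λ x → map (x ∷_) (listsOfLength ℓ n)) (upTo (suc n))

-- All lists of length ≤ n with entries ≤ n (every partition of n occurs exactly once).
candidates : ℕ → List (List ℕ)
candidates n = concatMap (λ ℓ → listsOfLength ℓ n) (upTo (suc n))

countPartitions : (n : ℕ) {P : Pred (List ℕ) Agda.Primitive.lzero} → Decidable P → ℕ
countPartitions n {P} P? = length (filter dec (candidates n))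
  where
  dec : Decidable (λ p → IsPartition n p × P p)
  dec p = (all? (1 ≤?_) p ×-dec linked? _≤?_ p ×-dec (sum p ≟ n)) ×-dec P? p

NS? : ∀ acc → Decidable (NS acc)
NS? acc []       = yes tt
NS? acc (x ∷ xs) = (acc ≤? x) ×-dec NS? (acc + x) xs

NonSquashing? : Decidable NonSquashing
NonSquashing? []       = yes tt
NonSquashing? (x ∷ xs) = NS? x xs

a : ℕ → ℕ → ℕ
a n k = countPartitions n (λ p → (length p ≟ k) ×-dec NonSquashing? p)

IsPow2 : ℕ → Set
IsPow2 x = ∃[ j ] x ≡ 2 ^ j

private
  j<2^j : ∀ j → j < 2 ^ j
  j<2^j zero    = s≤s z≤n
  j<2^j (suc j) = ≤-trans (s≤s (j<2^j j)) (subst (λ t → suc (2 ^ j) ≤ 2 ^ j + t) (sym (+-identityʳ (2 ^ j))) (+-monoˡ-≤ (2 ^ j) (1≤2^ j)))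
    where
    1≤2^ : ∀ i → 1 ≤ 2 ^ i
    1≤2^ i = ≤-trans (s≤s z≤n) (j<2^j i)

IsPow2? : Decidable IsPow2
IsPow2? x = map′ to from (any? {n = suc x} (λ (j : Fin (suc x)) → x ≟ 2 ^ toℕ j))
  where
  to : ∃ (λ (j : Fin (suc x)) → x ≡ 2 ^ toℕ j) → IsPow2 x
  to (j , e) = toℕ j , e
  from : IsPow2 x → ∃ (λ (j : Fin (suc x)) → x ≡ 2 ^ toℕ j)
  from (j , e) = fromℕ< j<sx , subst (λ t → x ≡ 2 ^ t) (sym (toℕ-fromℕ< j<sx)) e
    where
    j<sx : j < suc x
    j<sx = ≤-trans (j<2^j j) (subst (λ t → t ≤ suc x) e (n≤1+n x))

IsPow2≤ : ℕ → ℕ → Set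
IsPow2≤ e x = IsPow2 x × x ≤ 2 ^ e

IsPow2≤? : ∀ e → Decidable (IsPow2≤ e)
IsPow2≤? e x = IsPow2? x ×-dec (x ≤? 2 ^ e)

largest : List ℕ → ℕ
largest = foldr _⊔_ 0

pow2PartsBounded : ℕ → ℕ → ℕ
pow2PartsBounded n e = countPartitions n (all? (IsPow2≤? e))

pow2PartsLargest : ℕ → ℕ → ℕ
pow2PartsLargest n e = countPartitions n (λ p → all? IsPow2? p ×-dec (largest p ≟ 2 ^ e))

Series : Set
Series = ℕ → ℤ

_≈ₛ_ : Series → Series → Set
f ≈ₛ g = ∀ n → f n ≡ g n

_⊛_ : Series → Series → Series
(f ⊛ g) n = foldr ℤ._+_ 0ℤ (map (λ i → f i ℤ.* g (n ∸ i)) (upTo (suc n)))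

xpow : ℕ → Series
xpow d n with n ≟ d
... | yes _ = 1ℤ
... | no  _ = 0ℤ

one : Series
one = xpow 0

oneMinusXpow : ℕ → Series
oneMinusXpow d n = one n ℤ.- xpow d n

prodPow2 : ℕ → Series
prodPow2 r = foldr (λ j s → oneMinusXpow (2 ^ j) ⊛ s) one (upTo r)

gf : (ℕ → ℕ) → Series
gf c m = ℤ.+ (c m)

-- Removing the largest part of a non-squashing partition of n ≥ 1 into k + 1 parts leaves a
-- non-squashing partition of some r with r ≤ n − r, i.e. r ≤ ⌊n/2⌋, into k parts, and every such
-- partition extends uniquely; hence a(n, k+1) = Σ_{r ≤ ⌊n/2⌋} a(r, k).  This gives the recurrences,
-- and for the series A_k = Σ_n a(n,k) xⁿ it says (1 − x) A_{k+1}(x) = A_k(x²) and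
-- (1 − x) Σ_m a(2m, k+1) xᵐ = A_k(x) for k ≥ 1, while (1 − x) A₁ = x.  By induction,
-- A_k · ∏_{j<k} (1 − x^{2^j}) = x^{2^{k−1}}.
--
-- Removing the largest part in the same way shows that the series B_e of partitions into powers of
-- two at most 2^e satisfies (1 − x^{2^e}) B_e = B_{e−1} and (1 − x) B₀ = 1, hence
-- B_e · ∏_{j≤e} (1 − x^{2^j}) = 1.  Multiplication by 1 − x^d (d ≥ 1) is injective, so
-- A_{e+1} = x^{2^e} B_e, which is consequence (i); the partitions into powers of two with largest
-- part 2^e are counted by x^{2^e} B_e as well, which gives (ii).
--
-- The bijections are realised on the enumeration underlying countPartitions, by regrouping the
-- enumerated lists according to their last entry.
module Submission where

open import Defs
open import Algebra.Structures using (IsCommutativeMonoid)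
open import Data.Bool using (true; false)
open import Data.Empty using (⊥-elim)
open import Data.List using (List; []; _∷_; _∷ʳ_; _++_; length; map; foldr; filter; concatMap; applyUpTo; upTo)
open import Data.List.Properties using (length-++; filter-++; filter-≐; filter-reject; foldr-++; upTo-∷ʳ; map-upTo)
open import Data.List.Relation.Unary.All as All using (All; []; _∷_; all?)
import Data.List.Relation.Unary.All.Properties as All
open import Data.List.Relation.Unary.Linked using (Linked; []; [-]; _∷_; linked?)
open import Data.Nat using (ℕ; zero; suc; _∸_; _^_; _<_; _≤_; z≤n; s≤s; _≟_; _≤?_; _<?_; ⌊_/2⌋; ⌈_/2⌉)
open import Data.Nat.ListAction using (sum)
open import Data.Nat.ListAction.Properties using (sum-++)
open import Data.Nat.Properties
open import Data.Product using (_×_; _,_; proj₁; proj₂)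
open import Data.Sum as Sum using (_⊎_; inj₁; inj₂; [_,_])
open import Data.Unit using (tt)
open import Function using (id; _∘_; _⇔_; mk⇔; Equivalence)
open import Level using (0ℓ)
open import Relation.Binary.PropositionalEquality hiding ([_])
open import Relation.Nullary using (Dec; yes; no; ¬_; does)
open import Relation.Nullary.Decidable using (_×-dec_)
open import Relation.Unary using (Pred; Decidable)

open Equivalence using (to; from)

module FiniteSum {A : Set} {_∙_ : A → A → A} {ε : A} (isCommutativeMonoid : IsCommutativeMonoid _≡_ _∙_ ε) where

  open import Algebra.Bundles using (CommutativeMonoid)
  open import Data.Nat using (_+_)
  open IsCommutativeMonoid isCommutativeMonoid using (assoc; comm; identityˡ; identityʳ)

  commutativeMonoid : CommutativeMonoid 0ℓ 0ℓ
  commutativeMonoid = record { isCommutativeMonoid = isCommutativeMonoid }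

  open import Algebra.Properties.CommutativeSemigroup (CommutativeMonoid.commutativeSemigroup commutativeMonoid)
    using (interchange)
  open ≡-Reasoning

  Σ< : ℕ → (ℕ → A) → A
  Σ< zero    f = ε
  Σ< (suc n) f = f 0 ∙ Σ< n (λ i → f (suc i))

  Σ-applyUpTo : ∀ n (f : ℕ → A) (g : ℕ → ℕ) → foldr _∙_ ε (map f (applyUpTo g n)) ≡ Σ< n (λ i → f (g i))
  Σ-applyUpTo zero    f g = refl
  Σ-applyUpTo (suc n) f g = cong (f (g 0) ∙_) (Σ-applyUpTo n f (λ i → g (suc i)))

  Σ-cong : ∀ n {f g : ℕ → A} → (∀ i → i < n → f i ≡ g i) → Σ< n f ≡ Σ< n g
  Σ-cong zero    f≡g = refl
  Σ-cong (suc n) f≡g = cong₂ _∙_ (f≡g 0 (s≤s z≤n)) (Σ-cong n (λ i i<n → f≡g (suc i) (s≤s i<n)))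

  Σ-zero : ∀ n {f : ℕ → A} → (∀ i → i < n → f i ≡ ε) → Σ< n f ≡ ε
  Σ-zero zero    f≡ε = refl
  Σ-zero (suc n) f≡ε =
    trans (cong₂ _∙_ (f≡ε 0 (s≤s z≤n)) (Σ-zero n (λ i i<n → f≡ε (suc i) (s≤s i<n)))) (identityˡ ε)

  Σ-distrib : ∀ n (f g : ℕ → A) → Σ< n (λ i → f i ∙ g i) ≡ Σ< n f ∙ Σ< n g
  Σ-distrib zero    f g = sym (identityˡ ε)
  Σ-distrib (suc n) f g = trans (cong ((f 0 ∙ g 0) ∙_) (Σ-distrib n (λ i → f (suc i)) (λ i → g (suc i))))
                                (interchange (f 0) (g 0) _ _)

  Σ-comm : ∀ m n (h : ℕ → ℕ → A) → Σ< m (λ i → Σ< n (h i)) ≡ Σ< n (λ j → Σ< m (λ i → h i j))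
  Σ-comm zero    n h = sym (Σ-zero n (λ _ _ → refl))
  Σ-comm (suc m) n h = trans (cong (Σ< n (h 0) ∙_) (Σ-comm m n (λ i → h (suc i))))
                             (sym (Σ-distrib n (h 0) (λ j → Σ< m (λ i → h (suc i) j))))

  Σ-split : ∀ m n (f : ℕ → A) → Σ< (m + n) f ≡ Σ< m f ∙ Σ< n (λ j → f (m + j))
  Σ-split zero    n f = sym (identityˡ _)
  Σ-split (suc m) n f = trans (cong (f 0 ∙_) (Σ-split m n (λ i → f (suc i)))) (sym (assoc _ _ _))

  Σ-last : ∀ n (f : ℕ → A) → Σ< (suc n) f ≡ Σ< n f ∙ f n
  Σ-last zero    f = trans (identityʳ (f 0)) (sym (identityˡ (f 0)))
  Σ-last (suc n) f = trans (cong (f 0 ∙_) (Σ-last n (λ i → f (suc i)))) (sym (assoc _ _ _))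

  Σ-single : ∀ n c (f : ℕ → A) → c < n → (∀ i → i < n → i ≢ c → f i ≡ ε) → Σ< n f ≡ f c
  Σ-single (suc n) zero    f _         f≡ε =
    trans (cong (f 0 ∙_) (Σ-zero n (λ i i<n → f≡ε (suc i) (s≤s i<n) (λ ())))) (identityʳ (f 0))
  Σ-single (suc n) (suc c) f (s≤s c<n) f≡ε =
    trans (cong₂ _∙_ (f≡ε 0 (s≤s z≤n) (λ ())) (Σ-single n c (λ i → f (suc i)) c<n f∘suc≡ε)) (identityˡ _)
    where
    f∘suc≡ε : ∀ i → i < n → i ≢ c → f (suc i) ≡ ε
    f∘suc≡ε i i<n i≢c = f≡ε (suc i) (s≤s i<n) (i≢c ∘ suc-injective)

  Σ-reflect : ∀ n (f : ℕ → A) → Σ< (suc n) (λ i → f (n ∸ i)) ≡ Σ< (suc n) f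
  Σ-reflect zero    f = refl
  Σ-reflect (suc n) f = begin
    f (suc n) ∙ Σ< (suc n) (λ i → f (n ∸ i))  ≡⟨ cong (f (suc n) ∙_) (Σ-reflect n f) ⟩
    f (suc n) ∙ Σ< (suc n) f                  ≡⟨ comm _ _ ⟩
    Σ< (suc n) f ∙ f (suc n)                  ≡⟨ Σ-last (suc n) f ⟨
    Σ< (suc (suc n)) f                        ∎

-- In power series notation shift d f = x^d f, Δ d f = (1 − x^d) f, ΔΠ L f = ∏_{j ∈ L} (1 − x^{2^j}) f
-- and stretch f = f(x²).
module PowerSeries where

  open import Data.Integer as ℤ using (ℤ; 0ℤ; 1ℤ; _+_; _-_; _*_)
  import Data.Integer.Properties as ℤ
  open import Data.Integer.Tactic.RingSolver using (solve-∀)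
  import Data.Nat as ℕ
  open import Data.Nat.Induction using (<-rec)
  import Relation.Binary.Reasoning.Setoid as SetoidReasoning

  module ≈ₛ-Reasoning = SetoidReasoning (ℕ →-setoid ℤ)
  module Σℤ = FiniteSum ℤ.+-0-isCommutativeMonoid

  infixl 6 _-ₛ_

  _-ₛ_ : Series → Series → Series
  (f -ₛ g) n = f n - g n

  -ₛ-cong : ∀ {f f′ g g′} → f ≈ₛ f′ → g ≈ₛ g′ → (f -ₛ g) ≈ₛ (f′ -ₛ g′)
  -ₛ-cong f≈f′ g≈g′ n = cong₂ _-_ (f≈f′ n) (g≈g′ n)

  shift : ℕ → Series → Series
  shift zero    f n       = f n
  shift (suc d) f zero    = 0ℤ
  shift (suc d) f (suc n) = shift d f n

  shift-cong : ∀ d {f g} → f ≈ₛ g → shift d f ≈ₛ shift d g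
  shift-cong zero    f≈g n       = f≈g n
  shift-cong (suc d) f≈g zero    = refl
  shift-cong (suc d) f≈g (suc n) = shift-cong d f≈g n

  shift-< : ∀ d f {n} → n < d → shift d f n ≡ 0ℤ
  shift-< (suc d) f {zero}  _         = refl
  shift-< (suc d) f {suc n} (s≤s n<d) = shift-< d f n<d

  shift-+ : ∀ d f m → shift d f (d ℕ.+ m) ≡ f m
  shift-+ zero    f m = refl
  shift-+ (suc d) f m = shift-+ d f m

  shift-shift : ∀ d e f → shift d (shift e f) ≈ₛ shift (d ℕ.+ e) f
  shift-shift zero    e f n       = refl
  shift-shift (suc d) e f zero    = refl
  shift-shift (suc d) e f (suc n) = shift-shift d e f n

  shift-comm : ∀ d e f → shift d (shift e f) ≈ₛ shift e (shift d f)
  shift-comm d e f n =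
    trans (shift-shift d e f n) (trans (cong (λ s → shift s f n) (+-comm d e)) (sym (shift-shift e d f n)))

  shift-distrib-ₛ : ∀ d f g → shift d (f -ₛ g) ≈ₛ (shift d f -ₛ shift d g)
  shift-distrib-ₛ zero    f g n       = refl
  shift-distrib-ₛ (suc d) f g zero    = refl
  shift-distrib-ₛ (suc d) f g (suc n) = shift-distrib-ₛ d f g n

  shift-local : ∀ d {f g n} → 1 ≤ d → (∀ {i} → i < n → f i ≡ g i) → shift d f n ≡ shift d g n
  shift-local d {f} {g} {n} 1≤d f≡g with d ≤? n
  ... | yes d≤n with m , refl ← m≤n⇒∃[o]m+o≡n d≤n =
    trans (shift-+ d f m) (trans (f≡g (m<n+m m 1≤d)) (sym (shift-+ d g m)))
  ... | no d≰n = trans (shift-< d f (≰⇒> d≰n)) (sym (shift-< d g (≰⇒> d≰n)))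

  Δ : ℕ → Series → Series
  Δ d f = f -ₛ shift d f

  Δ-cong : ∀ d {f g} → f ≈ₛ g → Δ d f ≈ₛ Δ d g
  Δ-cong d f≈g = -ₛ-cong f≈g (shift-cong d f≈g)

  shift-Δ : ∀ d e f → shift d (Δ e f) ≈ₛ Δ e (shift d f)
  shift-Δ d e f n =
    trans (shift-distrib-ₛ d f (shift e f) n) (cong (λ t → shift d f n - t) (shift-comm d e f n))

  Δ-comm : ∀ d e f → Δ d (Δ e f) ≈ₛ Δ e (Δ d f)
  Δ-comm d e f n = begin
    (f n - shift e f n) - shift d (Δ e f) n
      ≡⟨ cong (λ t → (f n - shift e f n) - t) (shift-Δ d e f n) ⟩
    (f n - shift e f n) - (shift d f n - shift e (shift d f) n)
      ≡⟨ exchange (f n) (shift e f n) (shift d f n) (shift e (shift d f) n) ⟩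
    (f n - shift d f n) - (shift e f n - shift e (shift d f) n)
      ≡⟨ cong (λ t → (f n - shift d f n) - t) (shift-distrib-ₛ e f (shift d f) n) ⟨
    (f n - shift d f n) - shift e (Δ d f) n
      ∎
    where
    open ≡-Reasoning
    exchange : ∀ w x y z → (w - x) - (y - z) ≡ (w - y) - (x - z)
    exchange = solve-∀

  Δ-injective : ∀ d {f g} → 1 ≤ d → Δ d f ≈ₛ Δ d g → f ≈ₛ g
  Δ-injective d {f} {g} 1≤d Δf≈Δg = <-rec (λ n → f n ≡ g n) step
    where
    cancel : ∀ {a b c e} → a - b ≡ c - e → b ≡ e → a ≡ c
    cancel {a} {b} {c} a-b≡c-b refl = trans (sym (undo a b)) (trans (cong (_+ b) a-b≡c-b) (undo c b))
      where
      undo : ∀ x y → (x - y) + y ≡ x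
      undo = solve-∀
    step : ∀ n → (∀ {i} → i < n → f i ≡ g i) → f n ≡ g n
    step n f≡g = cancel (Δf≈Δg n) (shift-local d 1≤d f≡g)

  ΔΠ : List ℕ → Series → Series
  ΔΠ L f = foldr (λ j → Δ (2 ^ j)) f L

  ΔΠ-cong : ∀ L {f g} → f ≈ₛ g → ΔΠ L f ≈ₛ ΔΠ L g
  ΔΠ-cong []      f≈g = f≈g
  ΔΠ-cong (j ∷ L) f≈g = Δ-cong (2 ^ j) (ΔΠ-cong L f≈g)

  Δ-ΔΠ : ∀ d L f → Δ d (ΔΠ L f) ≈ₛ ΔΠ L (Δ d f)
  Δ-ΔΠ d []      f n = refl
  Δ-ΔΠ d (j ∷ L) f n = trans (Δ-comm d (2 ^ j) (ΔΠ L f) n) (Δ-cong (2 ^ j) (Δ-ΔΠ d L f) n)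

  shift-ΔΠ : ∀ d L f → shift d (ΔΠ L f) ≈ₛ ΔΠ L (shift d f)
  shift-ΔΠ d []      f n = refl
  shift-ΔΠ d (j ∷ L) f n = trans (shift-Δ d (2 ^ j) (ΔΠ L f) n) (Δ-cong (2 ^ j) (shift-ΔΠ d L f) n)

  ΔΠ-injective : ∀ L {f g} → ΔΠ L f ≈ₛ ΔΠ L g → f ≈ₛ g
  ΔΠ-injective []      ΔΠf≈ΔΠg = ΔΠf≈ΔΠg
  ΔΠ-injective (j ∷ L) ΔΠf≈ΔΠg = ΔΠ-injective L (Δ-injective (2 ^ j) (m^n>0 2 j) ΔΠf≈ΔΠg)

  xpow-≡ : ∀ d → xpow d d ≡ 1ℤ
  xpow-≡ d with d ≟ d
  ... | yes _   = refl
  ... | no  d≢d = ⊥-elim (d≢d refl)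

  xpow-≢ : ∀ d {n} → n ≢ d → xpow d n ≡ 0ℤ
  xpow-≢ d {n} n≢d with n ≟ d
  ... | yes n≡d = ⊥-elim (n≢d n≡d)
  ... | no  _   = refl

  shift-one : ∀ d → shift d one ≈ₛ xpow d
  shift-one zero    n       = refl
  shift-one (suc d) zero    = sym (xpow-≢ (suc d) {0} (λ ()))
  shift-one (suc d) (suc n) with n ≟ d
  ... | yes refl = trans (shift-one n n) (trans (xpow-≡ n) (sym (xpow-≡ (suc n))))
  ... | no  n≢d  = trans (shift-one d n) (trans (xpow-≢ d n≢d) (sym (xpow-≢ (suc d) (n≢d ∘ suc-injective))))

  stretch : Series → Series
  stretch f zero          = f zero
  stretch f (suc zero)    = 0ℤ
  stretch f (suc (suc n)) = stretch (λ i → f (suc i)) n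

  stretch-cong : ∀ {f g} → f ≈ₛ g → stretch f ≈ₛ stretch g
  stretch-cong f≈g zero          = f≈g 0
  stretch-cong f≈g (suc zero)    = refl
  stretch-cong f≈g (suc (suc n)) = stretch-cong (λ i → f≈g (suc i)) n

  stretch-even : ∀ m f → stretch f (m ℕ.+ m) ≡ f m
  stretch-even zero    f = refl
  stretch-even (suc m) f = trans (cong (stretch f ∘ suc) (+-suc m m)) (stretch-even m (λ i → f (suc i)))

  stretch-odd : ∀ m f → stretch f (suc (m ℕ.+ m)) ≡ 0ℤ
  stretch-odd zero    f = refl
  stretch-odd (suc m) f = trans (cong (stretch f ∘ suc ∘ suc) (+-suc m m)) (stretch-odd m (λ i → f (suc i)))

  stretch-distrib-ₛ : ∀ f g → stretch (f -ₛ g) ≈ₛ (stretch f -ₛ stretch g)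
  stretch-distrib-ₛ f g zero          = refl
  stretch-distrib-ₛ f g (suc zero)    = refl
  stretch-distrib-ₛ f g (suc (suc n)) = stretch-distrib-ₛ (λ i → f (suc i)) (λ i → g (suc i)) n

  stretch-one : stretch one ≈ₛ one
  stretch-one zero          = refl
  stretch-one (suc zero)    = refl
  stretch-one (suc (suc n)) = stretch-zero n
    where
    stretch-zero : ∀ n → stretch (λ _ → 0ℤ) n ≡ 0ℤ
    stretch-zero zero          = refl
    stretch-zero (suc zero)    = refl
    stretch-zero (suc (suc n)) = stretch-zero n

  shift-stretch : ∀ d f → shift (d ℕ.+ d) (stretch f) ≈ₛ stretch (shift d f)
  shift-stretch zero    f n = refl
  shift-stretch (suc d) f n = trans (cong (λ s → shift (suc s) (stretch f) n) (+-suc d d)) (by-two n)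
    where
    by-two : ∀ n → shift (suc (suc (d ℕ.+ d))) (stretch f) n ≡ stretch (shift (suc d) f) n
    by-two zero          = refl
    by-two (suc zero)    = refl
    by-two (suc (suc n)) = shift-stretch d f n

  Δ-stretch : ∀ d f → Δ (d ℕ.+ d) (stretch f) ≈ₛ stretch (Δ d f)
  Δ-stretch d f n =
    trans (cong (λ t → stretch f n - t) (shift-stretch d f n)) (sym (stretch-distrib-ₛ f (shift d f) n))

  ΔΠ-stretch : ∀ L f → ΔΠ (map suc L) (stretch f) ≈ₛ stretch (ΔΠ L f)
  ΔΠ-stretch []      f n = refl
  ΔΠ-stretch (j ∷ L) f n = begin
    Δ (2 ^ suc j) (ΔΠ (map suc L) (stretch f)) n
      ≡⟨ cong (λ d → Δ d (ΔΠ (map suc L) (stretch f)) n) (cong (2 ^ j ℕ.+_) (+-identityʳ (2 ^ j))) ⟩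
    Δ (2 ^ j ℕ.+ 2 ^ j) (ΔΠ (map suc L) (stretch f)) n
      ≡⟨ Δ-cong (2 ^ j ℕ.+ 2 ^ j) (ΔΠ-stretch L f) n ⟩
    Δ (2 ^ j ℕ.+ 2 ^ j) (stretch (ΔΠ L f)) n
      ≡⟨ Δ-stretch (2 ^ j) (ΔΠ L f) n ⟩
    stretch (Δ (2 ^ j) (ΔΠ L f)) n
      ∎
    where open ≡-Reasoning

  stretch-xpow : ∀ c → stretch (xpow c) ≈ₛ xpow (c ℕ.+ c)
  stretch-xpow c = begin
    stretch (xpow c)              ≈⟨ stretch-cong (shift-one c) ⟨
    stretch (shift c one)         ≈⟨ shift-stretch c one ⟨
    shift (c ℕ.+ c) (stretch one) ≈⟨ shift-cong (c ℕ.+ c) stretch-one ⟩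
    shift (c ℕ.+ c) one           ≈⟨ shift-one (c ℕ.+ c) ⟩
    xpow (c ℕ.+ c)                ∎
    where open ≈ₛ-Reasoning

  data Parity : ℕ → Set where
    even : ∀ m → Parity (m ℕ.+ m)
    odd  : ∀ m → Parity (suc (m ℕ.+ m))

  parity : ∀ n → Parity n
  parity zero = even 0
  parity (suc n) with parity n
  ... | even m = odd m
  ... | odd m  = subst Parity (cong suc (+-suc m m)) (even (suc m))

  Δ₁-⌊/2⌋ : ∀ f → Δ 1 (λ n → f ⌊ n /2⌋) ≈ₛ stretch (Δ 1 f)
  Δ₁-⌊/2⌋ f n with parity n
  ... | even zero    = refl
  ... | even (suc m) = begin
    f ⌊ suc m ℕ.+ suc m /2⌋ - f ⌊ m ℕ.+ suc m /2⌋
      ≡⟨ cong₂ (λ i j → f i - f j) (sym (n≡⌊n+n/2⌋ (suc m)))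
                                   (trans (cong ⌊_/2⌋ (+-suc m m)) (sym (n≡⌈n+n/2⌉ m))) ⟩
    f (suc m) - f m
      ≡⟨ stretch-even (suc m) (Δ 1 f) ⟨
    stretch (Δ 1 f) (suc m ℕ.+ suc m)
      ∎
    where open ≡-Reasoning
  ... | odd m = begin
    f ⌊ suc (m ℕ.+ m) /2⌋ - f ⌊ m ℕ.+ m /2⌋
      ≡⟨ cong₂ (λ i j → f i - f j) (sym (n≡⌈n+n/2⌉ m)) (sym (n≡⌊n+n/2⌋ m)) ⟩
    f m - f m
      ≡⟨ ℤ.+-inverseʳ (f m) ⟩
    0ℤ
      ≡⟨ stretch-odd m (Δ 1 f) ⟨
    stretch (Δ 1 f) (suc (m ℕ.+ m))
      ∎
    where open ≡-Reasoning

  Σℤ-distrib-- : ∀ n (f g : ℕ → ℤ) → Σℤ.Σ< n (λ i → f i - g i) ≡ Σℤ.Σ< n f - Σℤ.Σ< n g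
  Σℤ-distrib-- zero    f g = refl
  Σℤ-distrib-- (suc n) f g =
    trans (cong ((f 0 - g 0) +_) (Σℤ-distrib-- n (λ i → f (suc i)) (λ i → g (suc i))))
          (regroup (f 0) (g 0) _ _)
    where
    regroup : ∀ a b c d → (a - b) + (c - d) ≡ (a + c) - (b + d)
    regroup = solve-∀

  ⊛-as-Σ : ∀ f g n → (f ⊛ g) n ≡ Σℤ.Σ< (suc n) (λ i → f i * g (n ∸ i))
  ⊛-as-Σ f g n = Σℤ.Σ-applyUpTo (suc n) (λ i → f i * g (n ∸ i)) (λ i → i)

  ⊛-cong : ∀ {f f′ g g′} → f ≈ₛ f′ → g ≈ₛ g′ → (f ⊛ g) ≈ₛ (f′ ⊛ g′)
  ⊛-cong {f} {f′} {g} {g′} f≈f′ g≈g′ n = begin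
    (f ⊛ g) n
      ≡⟨ ⊛-as-Σ f g n ⟩
    Σℤ.Σ< (suc n) (λ i → f i * g (n ∸ i))
      ≡⟨ Σℤ.Σ-cong (suc n) (λ i _ → cong₂ _*_ (f≈f′ i) (g≈g′ (n ∸ i))) ⟩
    Σℤ.Σ< (suc n) (λ i → f′ i * g′ (n ∸ i))
      ≡⟨ ⊛-as-Σ f′ g′ n ⟨
    (f′ ⊛ g′) n
      ∎
    where open ≡-Reasoning

  ⊛-comm : ∀ f g → (f ⊛ g) ≈ₛ (g ⊛ f)
  ⊛-comm f g n = begin
    (f ⊛ g) n                                          ≡⟨ ⊛-as-Σ f g n ⟩
    Σℤ.Σ< (suc n) (λ i → f i * g (n ∸ i))              ≡⟨ Σℤ.Σ-reflect n (λ i → f i * g (n ∸ i)) ⟨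
    Σℤ.Σ< (suc n) (λ i → f (n ∸ i) * g (n ∸ (n ∸ i)))  ≡⟨ Σℤ.Σ-cong (suc n) swap ⟩
    Σℤ.Σ< (suc n) (λ i → g i * f (n ∸ i))              ≡⟨ ⊛-as-Σ g f n ⟨
    (g ⊛ f) n                                          ∎
    where
    open ≡-Reasoning
    swap : ∀ i → i < suc n → f (n ∸ i) * g (n ∸ (n ∸ i)) ≡ g i * f (n ∸ i)
    swap i i<1+n =
      trans (cong (λ j → f (n ∸ i) * g j) (m∸[m∸n]≡n (≤-pred i<1+n))) (ℤ.*-comm (f (n ∸ i)) (g i))

  ⊛-identityˡ : ∀ g → (one ⊛ g) ≈ₛ g
  ⊛-identityˡ g n = begin
    (one ⊛ g) n
      ≡⟨ ⊛-as-Σ one g n ⟩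
    1ℤ * g n + Σℤ.Σ< n (λ i → 0ℤ * g (n ∸ suc i))
      ≡⟨ cong₂ _+_ (ℤ.*-identityˡ (g n)) (Σℤ.Σ-zero n (λ _ _ → refl)) ⟩
    g n + 0ℤ
      ≡⟨ ℤ.+-identityʳ (g n) ⟩
    g n
      ∎
    where open ≡-Reasoning

  ⊛-identityʳ : ∀ f → (f ⊛ one) ≈ₛ f
  ⊛-identityʳ f n = trans (⊛-comm f one n) (⊛-identityˡ f n)

  ⊛-distribʳ-ₛ : ∀ f g h → ((f -ₛ g) ⊛ h) ≈ₛ ((f ⊛ h) -ₛ (g ⊛ h))
  ⊛-distribʳ-ₛ f g h n = begin
    ((f -ₛ g) ⊛ h) n
      ≡⟨ ⊛-as-Σ (f -ₛ g) h n ⟩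
    Σℤ.Σ< (suc n) (λ i → (f i - g i) * h (n ∸ i))
      ≡⟨ Σℤ.Σ-cong (suc n) (λ i _ → distrib (f i) (g i) (h (n ∸ i))) ⟩
    Σℤ.Σ< (suc n) (λ i → f i * h (n ∸ i) - g i * h (n ∸ i))
      ≡⟨ Σℤ-distrib-- (suc n) (λ i → f i * h (n ∸ i)) (λ i → g i * h (n ∸ i)) ⟩
    Σℤ.Σ< (suc n) (λ i → f i * h (n ∸ i)) - Σℤ.Σ< (suc n) (λ i → g i * h (n ∸ i))
      ≡⟨ cong₂ _-_ (⊛-as-Σ f h n) (⊛-as-Σ g h n) ⟨
    (f ⊛ h) n - (g ⊛ h) n
      ∎
    where
    open ≡-Reasoning
    distrib : ∀ a b c → (a - b) * c ≡ a * c - b * c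
    distrib = solve-∀

  ⊛-shiftˡ : ∀ d f g → (shift d f ⊛ g) ≈ₛ shift d (f ⊛ g)
  ⊛-shiftˡ d f g n with d ≤? n
  ... | yes d≤n with m , refl ← m≤n⇒∃[o]m+o≡n d≤n = begin
    (shift d f ⊛ g) (d ℕ.+ m)
      ≡⟨ ⊛-as-Σ (shift d f) g (d ℕ.+ m) ⟩
    Σℤ.Σ< (suc (d ℕ.+ m)) h
      ≡⟨ cong (λ N → Σℤ.Σ< N h) (+-suc d m) ⟨
    Σℤ.Σ< (d ℕ.+ suc m) h
      ≡⟨ Σℤ.Σ-split d (suc m) h ⟩
    Σℤ.Σ< d h + Σℤ.Σ< (suc m) (λ j → h (d ℕ.+ j))
      ≡⟨ cong₂ _+_ (Σℤ.Σ-zero d (λ i i<d → cong (_* g (d ℕ.+ m ∸ i)) (shift-< d f i<d)))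
                   (Σℤ.Σ-cong (suc m) (λ j _ → cong₂ _*_ (shift-+ d f j) (cong g ([m+n]∸[m+o]≡n∸o d m j)))) ⟩
    0ℤ + Σℤ.Σ< (suc m) (λ j → f j * g (m ∸ j))
      ≡⟨ ℤ.+-identityˡ _ ⟩
    Σℤ.Σ< (suc m) (λ j → f j * g (m ∸ j))
      ≡⟨ ⊛-as-Σ f g m ⟨
    (f ⊛ g) m
      ≡⟨ shift-+ d (f ⊛ g) m ⟨
    shift d (f ⊛ g) (d ℕ.+ m)
      ∎
    where
    open ≡-Reasoning
    h : ℕ → ℤ
    h i = shift d f i * g (d ℕ.+ m ∸ i)
  ... | no d≰n = begin
    (shift d f ⊛ g) n
      ≡⟨ ⊛-as-Σ (shift d f) g n ⟩
    Σℤ.Σ< (suc n) (λ i → shift d f i * g (n ∸ i))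
      ≡⟨ Σℤ.Σ-zero (suc n) (λ i i<1+n → cong (_* g (n ∸ i)) (shift-< d f (<-≤-trans i<1+n (≰⇒> d≰n)))) ⟩
    0ℤ
      ≡⟨ shift-< d (f ⊛ g) (≰⇒> d≰n) ⟨
    shift d (f ⊛ g) n
      ∎
    where open ≡-Reasoning

  Δ-⊛ : ∀ d f g → (Δ d f ⊛ g) ≈ₛ Δ d (f ⊛ g)
  Δ-⊛ d f g n = trans (⊛-distribʳ-ₛ f (shift d f) g n) (cong (λ t → (f ⊛ g) n - t) (⊛-shiftˡ d f g n))

  ⊛-oneMinusXpow : ∀ d f g → (f ⊛ (oneMinusXpow d ⊛ g)) ≈ₛ Δ d (f ⊛ g)
  ⊛-oneMinusXpow d f g = begin
    f ⊛ (oneMinusXpow d ⊛ g)  ≈⟨ ⊛-cong {f} (λ _ → refl) (⊛-cong oneMinusXpow≈Δ-one (λ _ → refl)) ⟩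
    f ⊛ (Δ d one ⊛ g)         ≈⟨ ⊛-cong {f} (λ _ → refl) (Δ-⊛ d one g) ⟩
    f ⊛ Δ d (one ⊛ g)         ≈⟨ ⊛-cong {f} (λ _ → refl) (Δ-cong d (⊛-identityˡ g)) ⟩
    f ⊛ Δ d g                 ≈⟨ ⊛-comm f (Δ d g) ⟩
    Δ d g ⊛ f                 ≈⟨ Δ-⊛ d g f ⟩
    Δ d (g ⊛ f)               ≈⟨ Δ-cong d (⊛-comm g f) ⟩
    Δ d (f ⊛ g)               ∎
    where
    open ≈ₛ-Reasoning
    oneMinusXpow≈Δ-one : oneMinusXpow d ≈ₛ Δ d one
    oneMinusXpow≈Δ-one n = cong (λ t → one n - t) (sym (shift-one d n))

  ⊛-prodPow2 : ∀ r f → (f ⊛ prodPow2 r) ≈ₛ ΔΠ (upTo r) f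
  ⊛-prodPow2 r f = ⊛-foldr (upTo r)
    where
    ⊛-foldr : ∀ L → (f ⊛ foldr (λ j s → oneMinusXpow (2 ^ j) ⊛ s) one L) ≈ₛ ΔΠ L f
    ⊛-foldr []        = ⊛-identityʳ f
    ⊛-foldr (j ∷ L) n = trans (⊛-oneMinusXpow (2 ^ j) f _ n) (Δ-cong (2 ^ j) (⊛-foldr L) n)

open import Data.Nat using (_+_; _*_; _⊔_)
open FiniteSum +-0-isCommutativeMonoid

-- Counting enumerated lists

count : {A : Set} {P : Pred A 0ℓ} → Decidable P → List A → ℕ
count P? xs = length (filter P? xs)

module _ {A : Set} {P : Pred A 0ℓ} (P? : Decidable P) where

  count-++ : (xs ys : List A) → count P? (xs ++ ys) ≡ count P? xs + count P? ys
  count-++ xs ys = trans (cong length (filter-++ P? xs ys)) (length-++ (filter P? xs))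

  count-map : {B : Set} (f : B → A) (xs : List B) → count P? (map f xs) ≡ count (λ x → P? (f x)) xs
  count-map f []       = refl
  count-map f (x ∷ xs) with does (P? (f x))
  ... | true  = cong suc (count-map f xs)
  ... | false = count-map f xs

  count-concatMap : (g : ℕ → List A) (h : ℕ → ℕ) (n : ℕ) →
                    count P? (concatMap g (applyUpTo h n)) ≡ Σ< n (λ i → count P? (g (h i)))
  count-concatMap g h zero    = refl
  count-concatMap g h (suc n) =
    trans (count-++ (g (h 0)) _) (cong (count P? (g (h 0)) +_) (count-concatMap g (λ i → h (suc i)) n))

  count-cong : {Q : Pred A 0ℓ} (Q? : Decidable Q) → (∀ x → P x ⇔ Q x) → ∀ xs → count P? xs ≡ count Q? xs
  count-cong Q? P⇔Q xs = cong length (filter-≐ P? Q? (to (P⇔Q _) , from (P⇔Q _)) xs)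

  count-singleton : {Q : Pred A 0ℓ} (Q? : Decidable Q) {x y : A} → (P x → Q y) → (Q y → P x) →
                    count P? (x ∷ []) ≡ count Q? (y ∷ [])
  count-singleton Q? {x} {y} P⇒Q Q⇒P with P? x | Q? y
  ... | yes _  | yes _  = refl
  ... | no _   | no _   = refl
  ... | yes Px | no ¬Qy = ⊥-elim (¬Qy (P⇒Q Px))
  ... | no ¬Px | yes Qy = ⊥-elim (¬Px (Q⇒P Qy))

  count-none : (∀ x → ¬ P x) → ∀ xs → count P? xs ≡ 0
  count-none ¬P []       = refl
  count-none ¬P (x ∷ xs) = trans (cong length (filter-reject P? (¬P x))) (count-none ¬P xs)

private
  variable
    P Q R : Pred (List ℕ) 0ℓ

IsComposition : ℕ → List ℕ → Set
IsComposition n p = All (1 ≤_) p × sum p ≡ n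

sum-∷ʳ : ∀ p x → sum (p ∷ʳ x) ≡ sum p + x
sum-∷ʳ p x = trans (sum-++ p (x ∷ [])) (cong (sum p +_) (+-identityʳ x))

parts≤sum : ∀ p → All (_≤ sum p) p
parts≤sum []      = []
parts≤sum (x ∷ p) = m≤m+n x (sum p) ∷ All.map (λ y≤ → ≤-trans y≤ (m≤n+m (sum p) x)) (parts≤sum p)

length≤sum : ∀ {p} → All (1 ≤_) p → length p ≤ sum p
length≤sum []         = z≤n
length≤sum (1≤x ∷ ps) = +-mono-≤ 1≤x (length≤sum ps)

IsComposition-∷ʳ⁻ : ∀ {n} p x → IsComposition n (p ∷ʳ x) → IsComposition (n ∸ x) p
IsComposition-∷ʳ⁻ p x (positive , sum≡n) =
  proj₁ (All.∷ʳ⁻ positive) , trans (sym (m+n∸n≡m (sum p) x)) (cong (_∸ x) (trans (sym (sum-∷ʳ p x)) sum≡n))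

count-listsOfLength-∷ : ∀ ℓ B (P? : Decidable P) →
  count P? (listsOfLength (suc ℓ) B) ≡ Σ< (suc B) (λ x → count (λ p → P? (x ∷ p)) (listsOfLength ℓ B))
count-listsOfLength-∷ ℓ B P? =
  trans (count-concatMap P? (λ x → map (x ∷_) (listsOfLength ℓ B)) (λ i → i) (suc B))
        (Σ-cong (suc B) (λ x _ → count-map P? (x ∷_) (listsOfLength ℓ B)))

count-listsOfLength-∷ʳ : ∀ ℓ B (P? : Decidable P) →
  count P? (listsOfLength (suc ℓ) B) ≡ Σ< (suc B) (λ x → count (λ p → P? (p ∷ʳ x)) (listsOfLength ℓ B))
count-listsOfLength-∷ʳ zero    B P? =
  trans (count-listsOfLength-∷ zero B P?)
        (Σ-cong (suc B) (λ x _ → count-singleton (λ p → P? (x ∷ p)) (λ p → P? (p ∷ʳ x)) {[]} {[]} id id))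
count-listsOfLength-∷ʳ (suc ℓ) B P? = begin
  count P? (listsOfLength (suc (suc ℓ)) B)
    ≡⟨ count-listsOfLength-∷ (suc ℓ) B P? ⟩
  Σ< (suc B) (λ y → count (λ p → P? (y ∷ p)) (listsOfLength (suc ℓ) B))
    ≡⟨ Σ-cong (suc B) (λ y _ → count-listsOfLength-∷ʳ ℓ B (λ p → P? (y ∷ p))) ⟩
  Σ< (suc B) (λ y → Σ< (suc B) (λ x → count (λ p → P? (y ∷ p ∷ʳ x)) (listsOfLength ℓ B)))
    ≡⟨ Σ-comm (suc B) (suc B) (λ y x → count (λ p → P? (y ∷ p ∷ʳ x)) (listsOfLength ℓ B)) ⟩
  Σ< (suc B) (λ x → Σ< (suc B) (λ y → count (λ p → P? (y ∷ p ∷ʳ x)) (listsOfLength ℓ B)))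
    ≡⟨ Σ-cong (suc B) (λ x _ → count-listsOfLength-∷ ℓ B (λ p → P? (p ∷ʳ x))) ⟨
  Σ< (suc B) (λ x → count (λ p → P? (p ∷ʳ x)) (listsOfLength (suc ℓ) B))
    ∎
  where open ≡-Reasoning

count-listsOfLength-bounded : ∀ ℓ B d (P? : Decidable P) → (∀ p → P p → All (_≤ B) p) →
  count P? (listsOfLength ℓ (B + d)) ≡ count P? (listsOfLength ℓ B)
count-listsOfLength-bounded zero    B d     P? bounded = refl
count-listsOfLength-bounded {P} (suc ℓ) B d P? bounded = begin
  count P? (listsOfLength (suc ℓ) (B + d))
    ≡⟨ count-listsOfLength-∷ ℓ (B + d) P? ⟩
  Σ< (suc B + d) (λ x → count (λ p → P? (x ∷ p)) (listsOfLength ℓ (B + d)))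
    ≡⟨ Σ-split (suc B) d (λ x → count (λ p → P? (x ∷ p)) (listsOfLength ℓ (B + d))) ⟩
  Σ< (suc B) (λ x → count (λ p → P? (x ∷ p)) (listsOfLength ℓ (B + d)))
    + Σ< d (λ j → count (λ p → P? (suc B + j ∷ p)) (listsOfLength ℓ (B + d)))
    ≡⟨ cong₂ _+_ (Σ-cong (suc B) (λ x _ → count-listsOfLength-bounded ℓ B d (λ p → P? (x ∷ p)) tail-bounded))
                 (Σ-zero d (λ j _ → count-none (λ p → P? (suc B + j ∷ p)) (too-big j) (listsOfLength ℓ (B + d)))) ⟩
  Σ< (suc B) (λ x → count (λ p → P? (x ∷ p)) (listsOfLength ℓ B)) + 0
    ≡⟨ +-identityʳ _ ⟩
  Σ< (suc B) (λ x → count (λ p → P? (x ∷ p)) (listsOfLength ℓ B))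
    ≡⟨ count-listsOfLength-∷ ℓ B P? ⟨
  count P? (listsOfLength (suc ℓ) B)
    ∎
  where
  open ≡-Reasoning
  tail-bounded : ∀ {x} p → P (x ∷ p) → All (_≤ B) p
  tail-bounded p Px∷p with bounded _ Px∷p
  ... | _ ∷ p≤B = p≤B
  too-big : ∀ j p → ¬ P (suc B + j ∷ p)
  too-big j p P[x∷p] with bounded _ P[x∷p]
  ... | x≤B ∷ _ = <⇒≱ (s≤s (m≤m+n B j)) x≤B

count-listsOfLength-empty : ∀ ℓ B (P? : Decidable P) → (∀ p → P p → length p ≢ ℓ) →
  count P? (listsOfLength ℓ B) ≡ 0
count-listsOfLength-empty zero    B P? wrong-length with P? []
... | yes P[] = ⊥-elim (wrong-length [] P[] refl)
... | no  _   = refl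
count-listsOfLength-empty (suc ℓ) B P? wrong-length =
  trans (count-listsOfLength-∷ ℓ B P?)
        (Σ-zero (suc B) (λ x _ → count-listsOfLength-empty ℓ B (λ p → P? (x ∷ p))
                                   (λ p Px∷p → wrong-length (x ∷ p) Px∷p ∘ cong suc)))

countInBox : ℕ → ℕ → Decidable P → ℕ
countInBox N B P? = Σ< N (λ ℓ → count P? (listsOfLength ℓ B))

count-candidates : ∀ n (P? : Decidable P) → count P? (candidates n) ≡ countInBox (suc n) n P?
count-candidates n P? = count-concatMap P? (λ ℓ → listsOfLength ℓ n) (λ ℓ → ℓ) (suc n)

countInBox-compositions : ∀ {m N B} (P? : Decidable P) → (∀ p → P p → IsComposition m p) →
  m < N → m ≤ B → countInBox N B P? ≡ count P? (candidates m)
countInBox-compositions {P} {m} P? composition m<N m≤B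
  with d , refl ← m≤n⇒∃[o]m+o≡n m<N | e , refl ← m≤n⇒∃[o]m+o≡n m≤B = begin
  Σ< (suc m + d) (λ ℓ → count P? (listsOfLength ℓ (m + e)))
    ≡⟨ Σ-split (suc m) d (λ ℓ → count P? (listsOfLength ℓ (m + e))) ⟩
  Σ< (suc m) (λ ℓ → count P? (listsOfLength ℓ (m + e))) + Σ< d (λ j → count P? (listsOfLength (suc m + j) (m + e)))
    ≡⟨ cong₂ _+_ (Σ-cong (suc m) (λ ℓ _ → count-listsOfLength-bounded ℓ m e P? parts≤m))
                 (Σ-zero d (λ j _ → count-listsOfLength-empty (suc m + j) (m + e) P? (too-long j))) ⟩
  countInBox (suc m) m P? + 0
    ≡⟨ +-identityʳ _ ⟩
  countInBox (suc m) m P?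
    ≡⟨ count-candidates m P? ⟨
  count P? (candidates m)
    ∎
  where
  open ≡-Reasoning
  parts≤m : ∀ p → P p → All (_≤ m) p
  parts≤m p Pp with composition p Pp
  ... | _ , refl = parts≤sum p
  too-long : ∀ j p → P p → length p ≢ suc m + j
  too-long j p Pp length≡ with composition p Pp
  ... | positive , refl = <⇒≱ (s≤s (m≤m+n (sum p) j)) (subst (_≤ sum p) length≡ (length≤sum positive))

-- Grouping by the last entry x leaves the other entries ranging over lists of length at most n
-- with entries at most n, a box that countInBox-compositions shrinks to the enumeration for n ∸ x.
count-candidates-∷ʳ : ∀ m (P? : Decidable P) → (∀ p → P p → IsComposition (suc m) p) →
  count P? (candidates (suc m)) ≡ Σ< (suc (suc m)) (λ x → count (λ p → P? (p ∷ʳ x)) (candidates (suc m ∸ x)))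
count-candidates-∷ʳ {P} m P? composition = begin
  count P? (candidates (suc m))
    ≡⟨ count-candidates (suc m) P? ⟩
  count P? ([] ∷ []) + Σ< (suc m) (λ ℓ → count P? (listsOfLength (suc ℓ) (suc m)))
    ≡⟨ cong₂ _+_ (cong length (filter-reject P? ¬P[]))
                 (Σ-cong (suc m) (λ ℓ _ → count-listsOfLength-∷ʳ ℓ (suc m) P?)) ⟩
  Σ< (suc m) (λ ℓ → Σ< (suc (suc m)) (λ x → count (λ p → P? (p ∷ʳ x)) (listsOfLength ℓ (suc m))))
    ≡⟨ Σ-comm (suc m) (suc (suc m)) (λ ℓ x → count (λ p → P? (p ∷ʳ x)) (listsOfLength ℓ (suc m))) ⟩
  Σ< (suc (suc m)) (λ x → countInBox (suc m) (suc m) (λ p → P? (p ∷ʳ x)))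
    ≡⟨ Σ-cong (suc (suc m)) shrink ⟩
  Σ< (suc (suc m)) (λ x → count (λ p → P? (p ∷ʳ x)) (candidates (suc m ∸ x)))
    ∎
  where
  open ≡-Reasoning
  ¬P[] : ¬ P []
  ¬P[] P[] with composition [] P[]
  ... | _ , ()
  ¬P[p∷ʳ0] : ∀ p → ¬ P (p ∷ʳ 0)
  ¬P[p∷ʳ0] p P[p∷ʳ0] with All.∷ʳ⁻ (proj₁ (composition _ P[p∷ʳ0]))
  ... | _ , ()
  shrink : ∀ x → x < suc (suc m) →
    countInBox (suc m) (suc m) (λ p → P? (p ∷ʳ x)) ≡ count (λ p → P? (p ∷ʳ x)) (candidates (suc m ∸ x))
  shrink zero _ =
    trans (Σ-zero (suc m) (λ ℓ _ → count-none (λ p → P? (p ∷ʳ 0)) ¬P[p∷ʳ0] (listsOfLength ℓ (suc m))))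
          (sym (count-none (λ p → P? (p ∷ʳ 0)) ¬P[p∷ʳ0] (candidates (suc m))))
  shrink (suc x) (s≤s (s≤s x≤m)) =
    countInBox-compositions (λ p → P? (p ∷ʳ suc x)) (λ p Pp → IsComposition-∷ʳ⁻ p (suc x) (composition _ Pp))
                            (s≤s (m∸n≤m m x)) (m∸n≤m (suc m) (suc x))

-- Partitions by their largest part

when : {C : Set} → Dec C → ℕ → ℕ
when (yes _) v = v
when (no _)  v = 0

when-yes : ∀ {C : Set} (C? : Dec C) {v} → C → when C? v ≡ v
when-yes (yes _) _ = refl
when-yes (no ¬c) c = ⊥-elim (¬c c)

when-no : ∀ {C : Set} (C? : Dec C) {v} → ¬ C → when C? v ≡ 0
when-no (yes c) ¬c = ⊥-elim (¬c c)
when-no (no _)  _  = refl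

when-⊎ : ∀ {C C₁ C₂ : Set} (C? : Dec C) (C₁? : Dec C₁) (C₂? : Dec C₂) {v} →
         C ⇔ (C₁ ⊎ C₂) → (C₁ → ¬ C₂) → when C? v ≡ when C₁? v + when C₂? v
when-⊎ C? (yes c₁) (yes c₂) C⇔ disjoint = ⊥-elim (disjoint c₁ c₂)
when-⊎ C? (yes c₁) (no _)   C⇔ disjoint = trans (when-yes C? (from C⇔ (inj₁ c₁))) (sym (+-identityʳ _))
when-⊎ C? (no _)   (yes c₂) C⇔ disjoint = when-yes C? (from C⇔ (inj₂ c₂))
when-⊎ C? (no ¬c₁) (no ¬c₂) C⇔ disjoint = when-no C? (λ c → [ ¬c₁ , ¬c₂ ] (to C⇔ c))

module _ {C : ℕ → Set} (C? : ∀ i → Dec (C i)) (f : ℕ → ℕ) where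

  Σ-when-< : ∀ N c → c ≤ N → (∀ i → i < N → C i ⇔ i < c) → Σ< N (λ i → when (C? i) (f i)) ≡ Σ< c f
  Σ-when-< N c c≤N C⇔ with d , refl ← m≤n⇒∃[o]m+o≡n c≤N = begin
    Σ< (c + d) (λ i → when (C? i) (f i))
      ≡⟨ Σ-split c d (λ i → when (C? i) (f i)) ⟩
    Σ< c (λ i → when (C? i) (f i)) + Σ< d (λ j → when (C? (c + j)) (f (c + j)))
      ≡⟨ cong₂ _+_ (Σ-cong c (λ i i<c → when-yes (C? i) (from (C⇔ i (≤-trans i<c (m≤m+n c d))) i<c)))
                   (Σ-zero d (λ j j<d → when-no (C? (c + j)) (λ C[c+j] →
                     <⇒≱ (to (C⇔ (c + j) (+-monoʳ-< c j<d)) C[c+j]) (m≤m+n c j)))) ⟩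
    Σ< c f + 0
      ≡⟨ +-identityʳ _ ⟩
    Σ< c f
      ∎
    where open ≡-Reasoning

  Σ-when-≡ : ∀ N c → c < N → (∀ i → i < N → C i ⇔ i ≡ c) → Σ< N (λ i → when (C? i) (f i)) ≡ f c
  Σ-when-≡ N c c<N C⇔ =
    trans (Σ-single N c _ c<N (λ i i<N i≢c → when-no (C? i) (i≢c ∘ to (C⇔ i i<N))))
          (when-yes (C? c) (from (C⇔ c c<N) refl))

  Σ-when-none : ∀ N → (∀ i → i < N → ¬ C i) → Σ< N (λ i → when (C? i) (f i)) ≡ 0
  Σ-when-none N ¬C = Σ-zero N (λ i i<N → when-no (C? i) (¬C i i<N))

IsPartition? : ∀ n → Decidable (IsPartition n)
IsPartition? n p = all? (1 ≤?_) p ×-dec linked? _≤?_ p ×-dec (sum p ≟ n)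

Linked-∷ʳ⁻ : ∀ p {x} → Linked _≤_ (p ∷ʳ x) → Linked _≤_ p × All (_≤ x) p
Linked-∷ʳ⁻ []          _              = [] , []
Linked-∷ʳ⁻ (y ∷ [])    (y≤x ∷ _)      = [-] , y≤x ∷ []
Linked-∷ʳ⁻ (y ∷ z ∷ p) (y≤z ∷ linked) with Linked-∷ʳ⁻ (z ∷ p) linked
... | linked′ , z≤x ∷ p≤x = y≤z ∷ linked′ , ≤-trans y≤z z≤x ∷ z≤x ∷ p≤x

Linked-∷ʳ⁺ : ∀ p {x} → Linked _≤_ p → All (_≤ x) p → Linked _≤_ (p ∷ʳ x)
Linked-∷ʳ⁺ []          _              _           = [-]
Linked-∷ʳ⁺ (y ∷ [])    _              (y≤x ∷ [])  = y≤x ∷ [-]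
Linked-∷ʳ⁺ (y ∷ z ∷ p) (y≤z ∷ linked) (_ ∷ z∷p≤x) = y≤z ∷ Linked-∷ʳ⁺ (z ∷ p) linked z∷p≤x

IsPartition-∷ʳ : ∀ {n x} p → x ≤ n →
  IsPartition n (p ∷ʳ x) ⇔ (IsPartition (n ∸ x) p × 1 ≤ x × All (_≤ x) p)
IsPartition-∷ʳ {n} {x} p x≤n = mk⇔ split join
  where
  split : IsPartition n (p ∷ʳ x) → IsPartition (n ∸ x) p × 1 ≤ x × All (_≤ x) p
  split (positive , linked , sum≡n) with All.∷ʳ⁻ positive | Linked-∷ʳ⁻ p linked
  ... | positive′ , 1≤x | linked′ , p≤x =
    (positive′ , linked′ , proj₂ (IsComposition-∷ʳ⁻ p x (positive , sum≡n))) , 1≤x , p≤x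
  join : IsPartition (n ∸ x) p × 1 ≤ x × All (_≤ x) p → IsPartition n (p ∷ʳ x)
  join ((positive , linked , sum≡n∸x) , 1≤x , p≤x) =
    All.∷ʳ⁺ positive 1≤x , Linked-∷ʳ⁺ p linked p≤x ,
    trans (sum-∷ʳ p x) (trans (cong (_+ x) sum≡n∸x) (m∸n+n≡m x≤n))

WithLastPart : ℕ → Pred (List ℕ) 0ℓ → Pred (List ℕ) 0ℓ
WithLastPart x Q p = 1 ≤ x × All (_≤ x) p × Q (p ∷ʳ x)

WithLastPart? : ∀ x → Decidable Q → Decidable (WithLastPart x Q)
WithLastPart? x Q? p = (1 ≤? x) ×-dec all? (_≤? x) p ×-dec Q? (p ∷ʳ x)

countPartitions-∷ʳ : ∀ m (Q? : Decidable Q) →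
  countPartitions (suc m) Q? ≡ Σ< (suc (suc m)) (λ x → countPartitions (suc m ∸ x) (WithLastPart? x Q?))
countPartitions-∷ʳ {Q} m Q? =
  trans (count-candidates-∷ʳ m (λ p → IsPartition? (suc m) p ×-dec Q? p)
                                (λ p ((positive , _ , sum≡) , _) → positive , sum≡))
        (Σ-cong (suc (suc m)) (λ x x<2+m →
          count-cong (λ p → IsPartition? (suc m) (p ∷ʳ x) ×-dec Q? (p ∷ʳ x))
                     (λ p → IsPartition? (suc m ∸ x) p ×-dec WithLastPart? x Q? p)
                     (regroup x (≤-pred x<2+m)) (candidates (suc m ∸ x))))
  where
  regroup : ∀ x → x ≤ suc m → ∀ p →
    (IsPartition (suc m) (p ∷ʳ x) × Q (p ∷ʳ x)) ⇔ (IsPartition (suc m ∸ x) p × WithLastPart x Q p)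
  regroup x x≤n p = mk⇔
    (λ (partition , Qp) → let (partition′ , 1≤x , p≤x) = to (IsPartition-∷ʳ p x≤n) partition
                          in partition′ , 1≤x , p≤x , Qp)
    (λ (partition′ , 1≤x , p≤x , Qp) → from (IsPartition-∷ʳ p x≤n) (partition′ , 1≤x , p≤x) , Qp)

countPartitions-when : ∀ n (P? : Decidable P) (R? : Decidable R) {C : Set} (C? : Dec C) →
  (∀ p → IsPartition n p → P p ⇔ (C × R p)) → countPartitions n P? ≡ when C? (countPartitions n R?)
countPartitions-when n P? R? C? P⇔ with C?
... | yes c = count-cong (λ p → IsPartition? n p ×-dec P? p) (λ p → IsPartition? n p ×-dec R? p)
                (λ p → mk⇔ (λ (partition , Pp) → partition , proj₂ (to (P⇔ p partition) Pp))
                           (λ (partition , Rp) → partition , from (P⇔ p partition) (c , Rp)))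
                (candidates n)
... | no ¬c = count-none (λ p → IsPartition? n p ×-dec P? p)
                (λ p (partition , Pp) → ¬c (proj₁ (to (P⇔ p partition) Pp))) (candidates n)

-- Non-squashing partitions

m≤n⇔m≤⌊m+n/2⌋ : ∀ m n → m ≤ n ⇔ m ≤ ⌊ m + n /2⌋
m≤n⇔m≤⌊m+n/2⌋ m n = mk⇔
  (λ m≤n → subst (_≤ ⌊ m + n /2⌋) (sym (n≡⌊n+n/2⌋ m)) (⌊n/2⌋-mono (+-monoʳ-≤ m m≤n)))
  (λ m≤⌊m+n/2⌋ → +-cancelˡ-≤ m m n (begin
    m + m                      ≤⟨ +-mono-≤ m≤⌊m+n/2⌋ (≤-trans m≤⌊m+n/2⌋ (⌊n/2⌋≤⌈n/2⌉ (m + n))) ⟩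
    ⌊ m + n /2⌋ + ⌈ m + n /2⌉  ≡⟨ ⌊n/2⌋+⌈n/2⌉≡n (m + n) ⟩
    m + n                      ∎))
  where open ≤-Reasoning

NS-∷ʳ : ∀ acc p x → NS acc (p ∷ʳ x) ⇔ (NS acc p × acc + sum p ≤ x)
NS-∷ʳ acc []      x = mk⇔ (λ (acc≤x , _) → tt , subst (_≤ x) (sym (+-identityʳ acc)) acc≤x)
                          (λ (_ , acc≤x) → subst (_≤ x) (+-identityʳ acc) acc≤x , tt)
NS-∷ʳ acc (y ∷ p) x = mk⇔
  (λ (acc≤y , ns) → let (ns′ , bound) = to (NS-∷ʳ (acc + y) p x) ns
                    in (acc≤y , ns′) , subst (_≤ x) (+-assoc acc y (sum p)) bound)
  (λ ((acc≤y , ns′) , bound) →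
    acc≤y , from (NS-∷ʳ (acc + y) p x) (ns′ , subst (_≤ x) (sym (+-assoc acc y (sum p))) bound))

NonSquashing-∷ʳ : ∀ p x → NonSquashing (p ∷ʳ x) ⇔ (NonSquashing p × sum p ≤ x)
NonSquashing-∷ʳ []      x = mk⇔ (λ _ → tt , z≤n) (λ _ → tt)
NonSquashing-∷ʳ (y ∷ p) x = NS-∷ʳ y p x

NonSquashing-lastPart : ∀ {n x k} p → x ≤ suc n → sum p ≡ suc n ∸ x →
  WithLastPart x (λ q → length q ≡ suc k × NonSquashing q) p ⇔
  (suc n ∸ x < suc ⌊ suc n /2⌋ × length p ≡ k × NonSquashing p)
NonSquashing-lastPart {n} {x} p x≤N sum≡r = mk⇔
  (λ (_ , _ , length≡ , ns) → let (ns′ , sum≤x) = to (NonSquashing-∷ʳ p x) ns in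
    s≤s (halve (subst (_≤ x) sum≡r sum≤x)) , suc-injective (trans (sym (length-∷ʳ p x)) length≡) , ns′)
  (λ (r<1+⌊N/2⌋ , length≡ , ns′) →
    let r≤x   = unhalve (≤-pred r<1+⌊N/2⌋)
        sum≤x = subst (_≤ x) (sym sum≡r) r≤x
    in positive r≤x , All.map (λ y≤sum → ≤-trans y≤sum sum≤x) (parts≤sum p) ,
       trans (length-∷ʳ p x) (cong suc length≡) , from (NonSquashing-∷ʳ p x) (ns′ , sum≤x))
  where
  r+x≡N : suc n ∸ x + x ≡ suc n
  r+x≡N = m∸n+n≡m x≤N
  halve : suc n ∸ x ≤ x → suc n ∸ x ≤ ⌊ suc n /2⌋
  halve r≤x = subst (λ t → suc n ∸ x ≤ ⌊ t /2⌋) r+x≡N (to (m≤n⇔m≤⌊m+n/2⌋ (suc n ∸ x) x) r≤x)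
  unhalve : suc n ∸ x ≤ ⌊ suc n /2⌋ → suc n ∸ x ≤ x
  unhalve r≤⌊N/2⌋ =
    from (m≤n⇔m≤⌊m+n/2⌋ (suc n ∸ x) x) (subst (λ t → suc n ∸ x ≤ ⌊ t /2⌋) (sym r+x≡N) r≤⌊N/2⌋)
  positive : ∀ {y} → suc n ∸ y ≤ y → 1 ≤ y
  positive {suc _} _ = s≤s z≤n
  positive {zero}  ()
  length-∷ʳ : ∀ (q : List ℕ) y → length (q ∷ʳ y) ≡ suc (length q)
  length-∷ʳ q y = trans (length-++ q) (+-comm (length q) 1)

a-suc-suc : ∀ n k → a (suc n) (suc k) ≡ Σ< (suc ⌊ suc n /2⌋) (λ r → a r k)
a-suc-suc n k = begin
  a (suc n) (suc k)
    ≡⟨ countPartitions-∷ʳ n Q? ⟩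
  Σ< (suc (suc n)) (λ x → countPartitions (suc n ∸ x) (WithLastPart? x Q?))
    ≡⟨ Σ-cong (suc (suc n)) (λ x x<2+n →
         countPartitions-when (suc n ∸ x) (WithLastPart? x Q?) (λ p → (length p ≟ k) ×-dec NonSquashing? p)
                              (suc n ∸ x <? suc ⌊ suc n /2⌋)
                              (λ p (_ , _ , sum≡) → NonSquashing-lastPart p (≤-pred x<2+n) sum≡)) ⟩
  Σ< (suc (suc n)) (λ x → f (suc n ∸ x))
    ≡⟨ Σ-reflect (suc n) f ⟩
  Σ< (suc (suc n)) f
    ≡⟨ Σ-when-< (λ r → r <? suc ⌊ suc n /2⌋) (λ r → a r k) (suc (suc n)) (suc ⌊ suc n /2⌋)
                (s≤s (⌊n/2⌋≤n (suc n))) (λ r _ → mk⇔ id id) ⟩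
  Σ< (suc ⌊ suc n /2⌋) (λ r → a r k)
    ∎
  where
  open ≡-Reasoning
  Q? : Decidable (λ p → length p ≡ suc k × NonSquashing p)
  Q? p = (length p ≟ suc k) ×-dec NonSquashing? p
  f : ℕ → ℕ
  f r = when (r <? suc ⌊ suc n /2⌋) (a r k)

a-suc-zero : ∀ n → a (suc n) 0 ≡ 0
a-suc-zero n =
  count-none (λ p → IsPartition? (suc n) p ×-dec ((length p ≟ 0) ×-dec NonSquashing? p)) impossible (candidates (suc n))
  where
  impossible : ∀ p → ¬ (IsPartition (suc n) p × length p ≡ 0 × NonSquashing p)
  impossible []      ((_ , _ , ()) , _)
  impossible (_ ∷ _) (_ , () , _)

a-suc-one : ∀ n → a (suc n) 1 ≡ 1
a-suc-one n = trans (a-suc-suc n 0) (cong (1 +_) (Σ-zero ⌊ suc n /2⌋ (λ r _ → a-suc-zero r)))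

a-halfSum : ∀ n k → a n (suc (suc k)) ≡ Σ< (suc ⌊ n /2⌋) (λ r → a r (suc k))
a-halfSum zero    k = refl
a-halfSum (suc n) k = a-suc-suc n (suc k)

a-< : ∀ n k → n < k → a n k ≡ 0
a-< zero    (suc k) _         = refl
a-< (suc n) (suc k) (s≤s n<k) =
  trans (a-suc-suc n k)
        (Σ-zero (suc ⌊ suc n /2⌋) (λ r r<1+⌊n/2⌋ →
          a-< r k (≤-<-trans (≤-pred r<1+⌊n/2⌋) (<-≤-trans (⌊n/2⌋<n n) n<k))))

2*m≡m+m : ∀ m → 2 * m ≡ m + m
2*m≡m+m m = cong (m +_) (+-identityʳ m)

a-odd : ∀ m k → a (suc (m + m)) (suc k) ≡ Σ< (suc m) (λ r → a r k)
a-odd m k = trans (a-suc-suc (m + m) k) (cong (λ h → Σ< (suc h) (λ r → a r k)) (sym (n≡⌈n+n/2⌉ m)))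

a-even : ∀ m k → a (suc m + suc m) (suc k) ≡ Σ< (suc (suc m)) (λ r → a r k)
a-even m k = trans (a-suc-suc (m + suc m) k) (cong (λ h → Σ< (suc h) (λ r → a r k)) (sym (n≡⌊n+n/2⌋ (suc m))))

a-recurrence-even : ∀ m k → 1 ≤ m → 1 ≤ k → a (2 * m) k ≡ a (2 * m ∸ 1) k + a m (k ∸ 1)
a-recurrence-even (suc m) (suc k) _ _ = begin
  a (2 * suc m) (suc k)                   ≡⟨ cong (λ n → a n (suc k)) (2*m≡m+m (suc m)) ⟩
  a (suc m + suc m) (suc k)               ≡⟨ a-even m k ⟩
  Σ< (suc (suc m)) (λ r → a r k)          ≡⟨ Σ-last (suc m) (λ r → a r k) ⟩
  Σ< (suc m) (λ r → a r k) + a (suc m) k  ≡⟨ cong (_+ a (suc m) k) (a-odd m k) ⟨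
  a (suc (m + m)) (suc k) + a (suc m) k   ≡⟨ cong (λ n → a n (suc k) + a (suc m) k) 2*[1+m]∸1≡1+m+m ⟨
  a (2 * suc m ∸ 1) (suc k) + a (suc m) k ∎
  where
  open ≡-Reasoning
  2*[1+m]∸1≡1+m+m : 2 * suc m ∸ 1 ≡ suc (m + m)
  2*[1+m]∸1≡1+m+m = trans (cong (_∸ 1) (2*m≡m+m (suc m))) (+-suc m m)

a-recurrence-odd : ∀ m k → 1 ≤ m → 1 ≤ k → a (2 * m + 1) k ≡ a (2 * m) k
a-recurrence-odd (suc m) (suc k) _ _ = begin
  a (2 * suc m + 1) (suc k)       ≡⟨ cong (λ n → a n (suc k)) 2*[1+m]+1≡1+[1+m]+[1+m] ⟩
  a (suc (suc m + suc m)) (suc k) ≡⟨ a-odd (suc m) k ⟩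
  Σ< (suc (suc m)) (λ r → a r k)  ≡⟨ a-even m k ⟨
  a (suc m + suc m) (suc k)       ≡⟨ cong (λ n → a n (suc k)) (2*m≡m+m (suc m)) ⟨
  a (2 * suc m) (suc k)           ∎
  where
  open ≡-Reasoning
  2*[1+m]+1≡1+[1+m]+[1+m] : 2 * suc m + 1 ≡ suc (suc m + suc m)
  2*[1+m]+1≡1+[1+m]+[1+m] = trans (+-comm (2 * suc m) 1) (cong suc (2*m≡m+m (suc m)))

-- Partitions into powers of two

Pow2AtMost : ℕ → ℕ → Set
Pow2AtMost X y = IsPow2 y × y ≤ X

Pow2AtMost? : ∀ X → Decidable (Pow2AtMost X)
Pow2AtMost? X y = IsPow2? y ×-dec (y ≤? X)

pow2PartsAtMost : ℕ → ℕ → ℕ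
pow2PartsAtMost n X = countPartitions n (all? (Pow2AtMost? X))

largest-∷ʳ : ∀ {x} p → All (_≤ x) p → largest (p ∷ʳ x) ≡ x
largest-∷ʳ {x} []      []          = ⊔-identityʳ x
largest-∷ʳ     (y ∷ p) (y≤x ∷ p≤x) = trans (cong (y ⊔_) (largest-∷ʳ p p≤x)) (m≤n⇒m⊔n≡n y≤x)

pow2≤2^[1+e] : ∀ e {x} → IsPow2 x → x ≤ 2 ^ suc e → x ≤ 2 ^ e ⊎ x ≡ 2 ^ suc e
pow2≤2^[1+e] e (j , refl) 2^j≤2^[1+e] with j ≤? e
... | yes j≤e = inj₁ (^-monoʳ-≤ 2 j≤e)
... | no  j≰e = inj₂ (cong (2 ^_) (≤-antisym j≤1+e (≰⇒> j≰e)))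
  where
  j≤1+e : j ≤ suc e
  j≤1+e = ≮⇒≥ (λ 1+e<j → <⇒≱ (^-monoʳ-< 2 (s≤s (s≤s z≤n)) 1+e<j) 2^j≤2^[1+e])

pow2PartsAtMost-∷ʳ : ∀ m X →
  pow2PartsAtMost (suc m) X ≡ Σ< (suc (suc m)) (λ x → when (Pow2AtMost? X x) (pow2PartsAtMost (suc m ∸ x) x))
pow2PartsAtMost-∷ʳ m X = begin
  pow2PartsAtMost (suc m) X
    ≡⟨ countPartitions-∷ʳ m (all? (Pow2AtMost? X)) ⟩
  Σ< (suc (suc m)) (λ x → countPartitions (suc m ∸ x) (WithLastPart? x (all? (Pow2AtMost? X))))
    ≡⟨ Σ-cong (suc (suc m)) (λ x _ → countPartitions-when (suc m ∸ x) (WithLastPart? x (all? (Pow2AtMost? X)))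
                                       (all? (Pow2AtMost? x)) (Pow2AtMost? X x) (λ p _ → lastPart x p)) ⟩
  Σ< (suc (suc m)) (λ x → when (Pow2AtMost? X x) (pow2PartsAtMost (suc m ∸ x) x))
    ∎
  where
  open ≡-Reasoning
  lastPart : ∀ x p → WithLastPart x (All (Pow2AtMost X)) p ⇔ (Pow2AtMost X x × All (Pow2AtMost x) p)
  lastPart x p = mk⇔
    (λ (_ , p≤x , all-p∷ʳx) → let (all-p , x-ok) = All.∷ʳ⁻ all-p∷ʳx
                              in x-ok , All.zip (All.map proj₁ all-p , p≤x))
    (λ { (((j , refl) , x≤X) , all-p) →
         let (p-pow2 , p≤x) = All.unzip all-p
         in m^n>0 2 j , p≤x ,
            All.∷ʳ⁺ (All.map (λ (y-pow2 , y≤x) → y-pow2 , ≤-trans y≤x x≤X) all-p) ((j , refl) , x≤X) })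

pow2PartsLargest-∷ʳ : ∀ m e →
  pow2PartsLargest (suc m) e ≡ Σ< (suc (suc m)) (λ x → when (x ≟ 2 ^ e) (pow2PartsAtMost (suc m ∸ x) x))
pow2PartsLargest-∷ʳ m e = begin
  pow2PartsLargest (suc m) e
    ≡⟨ countPartitions-∷ʳ m Q? ⟩
  Σ< (suc (suc m)) (λ x → countPartitions (suc m ∸ x) (WithLastPart? x Q?))
    ≡⟨ Σ-cong (suc (suc m)) (λ x _ → countPartitions-when (suc m ∸ x) (WithLastPart? x Q?) (all? (Pow2AtMost? x))
                                       (x ≟ 2 ^ e) (λ p _ → lastPart x p)) ⟩
  Σ< (suc (suc m)) (λ x → when (x ≟ 2 ^ e) (pow2PartsAtMost (suc m ∸ x) x))
    ∎
  where
  open ≡-Reasoning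
  Q? : Decidable (λ p → All IsPow2 p × largest p ≡ 2 ^ e)
  Q? p = all? IsPow2? p ×-dec (largest p ≟ 2 ^ e)
  lastPart : ∀ x p → WithLastPart x (λ q → All IsPow2 q × largest q ≡ 2 ^ e) p ⇔ (x ≡ 2 ^ e × All (Pow2AtMost x) p)
  lastPart x p = mk⇔
    (λ (_ , p≤x , all-pow2 , largest≡) →
      trans (sym (largest-∷ʳ p p≤x)) largest≡ , All.zip (proj₁ (All.∷ʳ⁻ all-pow2) , p≤x))
    (λ { (refl , all-p) → let (p-pow2 , p≤x) = All.unzip all-p
                          in m^n>0 2 e , p≤x , All.∷ʳ⁺ p-pow2 (e , refl) , largest-∷ʳ p p≤x })

pow2PartsLargest-zero : ∀ e → pow2PartsLargest 0 e ≡ 0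
pow2PartsLargest-zero e =
  count-none (λ p → IsPartition? 0 p ×-dec (all? IsPow2? p ×-dec (largest p ≟ 2 ^ e))) impossible (candidates 0)
  where
  impossible : ∀ p → ¬ (IsPartition 0 p × All IsPow2 p × largest p ≡ 2 ^ e)
  impossible []      (_ , _ , 0≡2^e)              = <⇒≢ (m^n>0 2 e) 0≡2^e
  impossible (x ∷ p) ((1≤x ∷ _ , _ , sum≡0) , _) = <⇒≱ (≤-trans 1≤x (m≤m+n x (sum p))) (≤-reflexive sum≡0)

pow2PartsLargest-≥ : ∀ n e → 2 ^ e ≤ n → pow2PartsLargest n e ≡ pow2PartsBounded (n ∸ 2 ^ e) e
pow2PartsLargest-≥ zero    e 2^e≤0 = ⊥-elim (<⇒≱ (m^n>0 2 e) 2^e≤0)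
pow2PartsLargest-≥ (suc m) e 2^e≤n =
  trans (pow2PartsLargest-∷ʳ m e)
        (Σ-when-≡ (λ x → x ≟ 2 ^ e) (λ x → pow2PartsAtMost (suc m ∸ x) x) (suc (suc m)) (2 ^ e) (s≤s 2^e≤n)
                  (λ x _ → mk⇔ id id))

pow2PartsLargest-< : ∀ n e → n < 2 ^ e → pow2PartsLargest n e ≡ 0
pow2PartsLargest-< zero    e _     = pow2PartsLargest-zero e
pow2PartsLargest-< (suc m) e n<2^e =
  trans (pow2PartsLargest-∷ʳ m e)
        (Σ-when-none (λ x → x ≟ 2 ^ e) (λ x → pow2PartsAtMost (suc m ∸ x) x) (suc (suc m))
                     (λ { x x<2+m refl → <⇒≱ n<2^e (≤-pred x<2+m) }))

pow2PartsBounded-zero : ∀ n → pow2PartsBounded n 0 ≡ 1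
pow2PartsBounded-zero zero    = refl
pow2PartsBounded-zero (suc m) =
  trans (pow2PartsAtMost-∷ʳ m 1)
        (trans (Σ-when-≡ (Pow2AtMost? 1) (λ x → pow2PartsAtMost (suc m ∸ x) x) (suc (suc m)) 1 (s≤s (s≤s z≤n))
                         (λ x _ → mk⇔ (λ { ((j , refl) , x≤1) → ≤-antisym x≤1 (m^n>0 2 j) })
                                      (λ { refl → (0 , refl) , ≤-refl })))
               (pow2PartsBounded-zero m))

pow2PartsBounded-suc : ∀ n e → pow2PartsBounded n (suc e) ≡ pow2PartsBounded n e + pow2PartsLargest n (suc e)
pow2PartsBounded-suc zero    e = sym (cong (1 +_) (pow2PartsLargest-zero (suc e)))
pow2PartsBounded-suc (suc m) e = begin
  pow2PartsAtMost (suc m) (2 ^ suc e)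
    ≡⟨ pow2PartsAtMost-∷ʳ m (2 ^ suc e) ⟩
  Σ< (suc (suc m)) (λ x → when (Pow2AtMost? (2 ^ suc e) x) (f x))
    ≡⟨ Σ-cong (suc (suc m)) (λ x _ → when-⊎ (Pow2AtMost? (2 ^ suc e) x) (Pow2AtMost? (2 ^ e) x) (x ≟ 2 ^ suc e)
                                             {f x} split (disjoint {x})) ⟩
  Σ< (suc (suc m)) (λ x → when (Pow2AtMost? (2 ^ e) x) (f x) + when (x ≟ 2 ^ suc e) (f x))
    ≡⟨ Σ-distrib (suc (suc m)) (λ x → when (Pow2AtMost? (2 ^ e) x) (f x)) (λ x → when (x ≟ 2 ^ suc e) (f x)) ⟩
  Σ< (suc (suc m)) (λ x → when (Pow2AtMost? (2 ^ e) x) (f x)) + Σ< (suc (suc m)) (λ x → when (x ≟ 2 ^ suc e) (f x))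
    ≡⟨ cong₂ _+_ (pow2PartsAtMost-∷ʳ m (2 ^ e)) (pow2PartsLargest-∷ʳ m (suc e)) ⟨
  pow2PartsAtMost (suc m) (2 ^ e) + pow2PartsLargest (suc m) (suc e)
    ∎
  where
  open ≡-Reasoning
  f : ℕ → ℕ
  f x = pow2PartsAtMost (suc m ∸ x) x
  2^e<2^[1+e] : 2 ^ e < 2 ^ suc e
  2^e<2^[1+e] = ^-monoʳ-< 2 (s≤s (s≤s z≤n)) (n<1+n e)
  split : ∀ {x} → Pow2AtMost (2 ^ suc e) x ⇔ (Pow2AtMost (2 ^ e) x ⊎ x ≡ 2 ^ suc e)
  split {x} = mk⇔
    (λ (x-pow2 , x≤2^[1+e]) → Sum.map₁ (x-pow2 ,_) (pow2≤2^[1+e] e x-pow2 x≤2^[1+e]))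
    (λ { (inj₁ (x-pow2 , x≤2^e)) → x-pow2 , ≤-trans x≤2^e (<⇒≤ 2^e<2^[1+e])
       ; (inj₂ refl)             → (suc e , refl) , ≤-refl })
  disjoint : ∀ {x} → Pow2AtMost (2 ^ e) x → x ≢ 2 ^ suc e
  disjoint (_ , x≤2^e) refl = <⇒≱ 2^e<2^[1+e] x≤2^e

-- Generating functions

open PowerSeries
open import Data.Integer as ℤ using (0ℤ; _-_)
import Data.Integer.Properties as ℤ

+[m+n]-+m≡+n : ∀ m n → ℤ.+ (m + n) - ℤ.+ m ≡ ℤ.+ n
+[m+n]-+m≡+n m n = trans (ℤ.m-n≡m⊖n (m + n) m) (trans (ℤ.⊖-≥ (m≤m+n m n)) (cong ℤ.+_ (m+n∸m≡n m n)))

Δ₁-partialSums : ∀ c → Δ 1 (gf (λ m → Σ< (suc m) c)) ≈ₛ gf c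
Δ₁-partialSums c zero    = trans (ℤ.+-identityʳ _) (cong ℤ.+_ (+-identityʳ (c 0)))
Δ₁-partialSums c (suc m) =
  trans (cong (λ t → ℤ.+ t - ℤ.+ Σ< (suc m) c) (Σ-last (suc m) c)) (+[m+n]-+m≡+n (Σ< (suc m) c) (c (suc m)))

A : ℕ → Series
A k = gf (λ n → a n k)

B : ℕ → Series
B e = gf (λ n → pow2PartsBounded n e)

Δ₁-A-one : Δ 1 (A 1) ≈ₛ xpow 1
Δ₁-A-one zero          = refl
Δ₁-A-one (suc zero)    = trans (cong (λ t → ℤ.+ t - 0ℤ) (a-suc-one 0)) (sym (xpow-≡ 1))
Δ₁-A-one (suc (suc n)) =
  trans (cong₂ (λ s t → ℤ.+ s - ℤ.+ t) (a-suc-one (suc n)) (a-suc-one n)) (sym (xpow-≢ 1 {suc (suc n)} (λ ())))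

Δ₁-A : ∀ k → Δ 1 (A (suc (suc k))) ≈ₛ stretch (A (suc k))
Δ₁-A k = begin
  Δ 1 (A (suc (suc k)))   ≈⟨ Δ-cong 1 (λ n → cong ℤ.+_ (a-halfSum n k)) ⟩
  Δ 1 (λ n → S ⌊ n /2⌋)   ≈⟨ Δ₁-⌊/2⌋ S ⟩
  stretch (Δ 1 S)         ≈⟨ stretch-cong (Δ₁-partialSums (λ r → a r (suc k))) ⟩
  stretch (A (suc k))     ∎
  where
  open ≈ₛ-Reasoning
  S : Series
  S = gf (λ m → Σ< (suc m) (λ r → a r (suc k)))

Δ₁-A-even : ∀ k → Δ 1 (gf (λ m → a (2 * m) (suc (suc k)))) ≈ₛ A (suc k)
Δ₁-A-even k = begin
  Δ 1 (gf (λ m → a (2 * m) (suc (suc k))))         ≈⟨ Δ-cong 1 (λ m → cong ℤ.+_ (a-double m)) ⟩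
  Δ 1 (gf (λ m → Σ< (suc m) (λ r → a r (suc k))))  ≈⟨ Δ₁-partialSums (λ r → a r (suc k)) ⟩
  A (suc k)                                        ∎
  where
  open ≈ₛ-Reasoning
  ⌊2*m/2⌋≡m : ∀ m → ⌊ 2 * m /2⌋ ≡ m
  ⌊2*m/2⌋≡m m = trans (cong ⌊_/2⌋ (2*m≡m+m m)) (sym (n≡⌊n+n/2⌋ m))
  a-double : ∀ m → a (2 * m) (suc (suc k)) ≡ Σ< (suc m) (λ r → a r (suc k))
  a-double m = trans (a-halfSum (2 * m) k) (cong (λ h → Σ< (suc h) (λ r → a r (suc k))) (⌊2*m/2⌋≡m m))

ΔΠ-A : ∀ k → ΔΠ (upTo (suc k)) (A (suc k)) ≈ₛ xpow (2 ^ k)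
ΔΠ-A zero    = Δ₁-A-one
ΔΠ-A (suc k) = begin
  Δ 1 (ΔΠ (applyUpTo suc (suc k)) (A (suc (suc k))))
    ≈⟨ Δ-ΔΠ 1 (applyUpTo suc (suc k)) (A (suc (suc k))) ⟩
  ΔΠ (applyUpTo suc (suc k)) (Δ 1 (A (suc (suc k))))
    ≈⟨ ΔΠ-cong (applyUpTo suc (suc k)) (Δ₁-A k) ⟩
  ΔΠ (applyUpTo suc (suc k)) (stretch (A (suc k)))
    ≡⟨ cong (λ L → ΔΠ L (stretch (A (suc k)))) (map-upTo suc (suc k)) ⟨
  ΔΠ (map suc (upTo (suc k))) (stretch (A (suc k)))
    ≈⟨ ΔΠ-stretch (upTo (suc k)) (A (suc k)) ⟩
  stretch (ΔΠ (upTo (suc k)) (A (suc k)))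
    ≈⟨ stretch-cong (ΔΠ-A k) ⟩
  stretch (xpow (2 ^ k))
    ≈⟨ stretch-xpow (2 ^ k) ⟩
  xpow (2 ^ k + 2 ^ k)
    ≡⟨ cong xpow (2*m≡m+m (2 ^ k)) ⟨
  xpow (2 ^ suc k)
    ∎
  where open ≈ₛ-Reasoning

pow2PartsLargest≈shift : ∀ e → gf (λ n → pow2PartsLargest n e) ≈ₛ shift (2 ^ e) (B e)
pow2PartsLargest≈shift e n with 2 ^ e ≤? n
... | yes 2^e≤n with m , refl ← m≤n⇒∃[o]m+o≡n 2^e≤n = begin
  ℤ.+ pow2PartsLargest (2 ^ e + m) e            ≡⟨ cong ℤ.+_ (pow2PartsLargest-≥ (2 ^ e + m) e 2^e≤n) ⟩
  ℤ.+ pow2PartsBounded (2 ^ e + m ∸ 2 ^ e) e    ≡⟨ cong (λ n → ℤ.+ pow2PartsBounded n e) (m+n∸m≡n (2 ^ e) m) ⟩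
  ℤ.+ pow2PartsBounded m e                      ≡⟨ shift-+ (2 ^ e) (B e) m ⟨
  shift (2 ^ e) (B e) (2 ^ e + m)               ∎
  where open ≡-Reasoning
... | no 2^e≰n = trans (cong ℤ.+_ (pow2PartsLargest-< n e (≰⇒> 2^e≰n))) (sym (shift-< (2 ^ e) (B e) (≰⇒> 2^e≰n)))

Δ-B : ∀ e → Δ (2 ^ suc e) (B (suc e)) ≈ₛ B e
Δ-B e n = begin
  ℤ.+ pow2PartsBounded n (suc e) - shift (2 ^ suc e) (B (suc e)) n
    ≡⟨ cong₂ (λ s t → ℤ.+ s - t) (trans (pow2PartsBounded-suc n e) (+-comm _ (pow2PartsLargest n (suc e))))
                                 (sym (pow2PartsLargest≈shift (suc e) n)) ⟩
  ℤ.+ (pow2PartsLargest n (suc e) + pow2PartsBounded n e) - ℤ.+ pow2PartsLargest n (suc e)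
    ≡⟨ +[m+n]-+m≡+n (pow2PartsLargest n (suc e)) (pow2PartsBounded n e) ⟩
  ℤ.+ pow2PartsBounded n e
    ∎
  where open ≡-Reasoning

Δ₁-B-zero : Δ 1 (B 0) ≈ₛ one
Δ₁-B-zero zero    = refl
Δ₁-B-zero (suc n) = cong₂ (λ s t → ℤ.+ s - ℤ.+ t) (pow2PartsBounded-zero (suc n)) (pow2PartsBounded-zero n)

ΔΠ-B : ∀ e → ΔΠ (upTo (suc e)) (B e) ≈ₛ one
ΔΠ-B zero    = Δ₁-B-zero
ΔΠ-B (suc e) = begin
  ΔΠ (upTo (suc (suc e))) (B (suc e))
    ≡⟨ cong (λ L → ΔΠ L (B (suc e))) (upTo-∷ʳ (suc e)) ⟨
  ΔΠ (upTo (suc e) ∷ʳ suc e) (B (suc e))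
    ≡⟨ foldr-++ (λ j → Δ (2 ^ j)) (B (suc e)) (upTo (suc e)) (suc e ∷ []) ⟩
  ΔΠ (upTo (suc e)) (Δ (2 ^ suc e) (B (suc e)))
    ≈⟨ ΔΠ-cong (upTo (suc e)) (Δ-B e) ⟩
  ΔΠ (upTo (suc e)) (B e)
    ≈⟨ ΔΠ-B e ⟩
  one
    ∎
  where open ≈ₛ-Reasoning

A≈shiftB : ∀ e → A (suc e) ≈ₛ shift (2 ^ e) (B e)
A≈shiftB e = ΔΠ-injective (upTo (suc e)) (begin
  ΔΠ (upTo (suc e)) (A (suc e))            ≈⟨ ΔΠ-A e ⟩
  xpow (2 ^ e)                             ≈⟨ shift-one (2 ^ e) ⟨
  shift (2 ^ e) one                        ≈⟨ shift-cong (2 ^ e) (ΔΠ-B e) ⟨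
  shift (2 ^ e) (ΔΠ (upTo (suc e)) (B e))  ≈⟨ shift-ΔΠ (2 ^ e) (upTo (suc e)) (B e) ⟩
  ΔΠ (upTo (suc e)) (shift (2 ^ e) (B e))  ∎)
  where open ≈ₛ-Reasoning

generatingFunction : ∀ k → 1 ≤ k → (gf (λ m → a m k) ⊛ prodPow2 k) ≈ₛ xpow (2 ^ (k ∸ 1))
generatingFunction (suc k) _ n = trans (⊛-prodPow2 (suc k) (A (suc k)) n) (ΔΠ-A k n)

generatingFunction-even : ∀ k → 2 ≤ k →
  (gf (λ m → a (2 * m) k) ⊛ (oneMinusXpow 1 ⊛ prodPow2 (k ∸ 1))) ≈ₛ xpow (2 ^ (k ∸ 2))
generatingFunction-even (suc (suc k)) (s≤s (s≤s z≤n)) = begin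
  E ⊛ (oneMinusXpow 1 ⊛ prodPow2 (suc k))  ≈⟨ ⊛-oneMinusXpow 1 E (prodPow2 (suc k)) ⟩
  Δ 1 (E ⊛ prodPow2 (suc k))               ≈⟨ Δ-cong 1 (⊛-prodPow2 (suc k) E) ⟩
  Δ 1 (ΔΠ (upTo (suc k)) E)                ≈⟨ Δ-ΔΠ 1 (upTo (suc k)) E ⟩
  ΔΠ (upTo (suc k)) (Δ 1 E)                ≈⟨ ΔΠ-cong (upTo (suc k)) (Δ₁-A-even k) ⟩
  ΔΠ (upTo (suc k)) (A (suc k))            ≈⟨ ΔΠ-A k ⟩
  xpow (2 ^ k)                             ∎
  where
  open ≈ₛ-Reasoning
  E : Series
  E = gf (λ m → a (2 * m) (suc (suc k)))

a≡pow2PartsBounded : ∀ e n → a (n + 2 ^ e) (suc e) ≡ pow2PartsBounded n e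
a≡pow2PartsBounded e n = ℤ.+-injective (begin
  A (suc e) (n + 2 ^ e)            ≡⟨ A≈shiftB e (n + 2 ^ e) ⟩
  shift (2 ^ e) (B e) (n + 2 ^ e)  ≡⟨ cong (shift (2 ^ e) (B e)) (+-comm n (2 ^ e)) ⟩
  shift (2 ^ e) (B e) (2 ^ e + n)  ≡⟨ shift-+ (2 ^ e) (B e) n ⟩
  B e n                            ∎)
  where open ≡-Reasoning

a-<2^ : ∀ e n → n < 2 ^ e → a n (suc e) ≡ 0
a-<2^ e n n<2^e = ℤ.+-injective (trans (A≈shiftB e n) (shift-< (2 ^ e) (B e) n<2^e))

a≡pow2PartsLargest : ∀ e n → a n (suc e) ≡ pow2PartsLargest n e
a≡pow2PartsLargest e n = ℤ.+-injective (trans (A≈shiftB e n) (sym (pow2PartsLargest≈shift e n)))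

theorem3 :
    -- recurrences
    (∀ m k → 1 ≤ m → 1 ≤ k → a (2 * m) k ≡ a (2 * m ∸ 1) k + a m (k ∸ 1))
    × (∀ m k → 1 ≤ m → 1 ≤ k → a (2 * m + 1) k ≡ a (2 * m) k)
    -- initial / boundary values
    × (a 0 0 ≡ 1)
    × (∀ n → 1 ≤ n → a n 0 ≡ 0)
    × (∀ n k → n < k → a n k ≡ 0)
    × (∀ n → 1 ≤ n → a n 1 ≡ 1)
    -- generating functions (as identities of formal power series over ℤ)
    × (∀ k → 2 ≤ k →
        (gf (λ m → a (2 * m) k) ⊛ (oneMinusXpow 1 ⊛ prodPow2 (k ∸ 1))) ≈ₛ xpow (2 ^ (k ∸ 2)))
    × (∀ k → 1 ≤ k →
        (gf (λ m → a m k) ⊛ prodPow2 k) ≈ₛ xpow (2 ^ (k ∸ 1)))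
    -- consequence (i)
    × (∀ k → 1 ≤ k →
        (∀ n → a (n + 2 ^ (k ∸ 1)) k ≡ pow2PartsBounded n (k ∸ 1))
        × (∀ n → n < 2 ^ (k ∸ 1) → a n k ≡ 0))
    -- consequence (ii)
    × (∀ k → 1 ≤ k → ∀ n → a n k ≡ pow2PartsLargest n (k ∸ 1))
theorem3 =
  a-recurrence-even ,
  a-recurrence-odd ,
  refl ,
  (λ { (suc n) _ → a-suc-zero n }) ,
  a-< ,
  (λ { (suc n) _ → a-suc-one n }) ,
  generatingFunction-even ,
  generatingFunction ,
  (λ { (suc e) _ → a≡pow2PartsBounded e , a-<2^ e }) ,
  (λ { (suc e) _ → a≡pow2PartsLargest e })
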